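{- The Mockingbird combinatory logic system is locally finite, has the poset property, and is rooted.
   Context: The Mockingbird CLS has a single basic combinator ${\rm M}$ with rule ${\rm M}\,\mathsf{x}_1 \to \mathsf{x}_1\mathsf{x}_1$. Its terms are the smallest set containing the variables $\mathsf{x}_1,\mathsf{x}_2,\dots$, the symbol ${\rm M}$, and $(\mathfrak{t}_1\mathfrak{t}_2)$ for terms $\mathfrak{t}_1,\mathfrak{t}_2$ (binary trees; application associates to the left). The rewrite relation $\Rightarrow$ is the smallest relation with ${\rm M}\,\mathfrak{s} \Rightarrow \mathfrak{s}\,\mathfrak{s}$ for every term $\mathfrak{s}$, and such that $\mathfrak{t}_1 \Rightarrow \mathfrak{t}_1'$ implies $\mathfrak{t}_1\mathfrak{t}_2 \Rightarrow \mathfrak{t}_1'\mathfrak{t}_2$ and $\mathfrak{t}_2\mathfrak{t}_1 \Rightarrow \mathfrak{t}_2\mathfrak{t}_1'$ for every term $\mathfrak{t}_2$. Let $\preccurlyeq$ be its reflexive and transitive closure and $\equiv$ its reflexive, symmetric and transitive closure. The system is locally finite if every $\equiv$-class is finite; it has the poset property if $\preccurlyeq$ is antisymmetric; it is rooted if it has the poset property and every $\equiv$-class has a unique minimal element for $\preccurlyeq$. -}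

module Defs where

open import Data.Nat using (ℕ)
open import Data.Product using (Σ; ∃; _×_; _,_)
open import Data.List using (List)
open import Data.List.Membership.Propositional using (_∈_)
open import Relation.Binary.PropositionalEquality using (_≡_)
open import Relation.Binary.Construct.Closure.ReflexiveTransitive using (Star)
open import Relation.Binary.Construct.Closure.Equivalence using (EqClosure)

infixl 9 _·_
infix 4 _⇒_ _≼_ _≈_

data Term : Set where
  var : ℕ → Term
  M   : Term
  _·_ : Term → Term → Term

data _⇒_ : Term → Term → Set where
  mock : ∀ s → M · s ⇒ s · s
  appˡ : ∀ {t₁ t₁′} t₂ → t₁ ⇒ t₁′ → t₁ · t₂ ⇒ t₁′ · t₂
  appʳ : ∀ {t₁ t₁′} t₂ → t₁ ⇒ t₁′ → t₂ · t₁ ⇒ t₂ · t₁′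

_≼_ : Term → Term → Set
_≼_ = Star _⇒_

_≈_ : Term → Term → Set
_≈_ = EqClosure _⇒_

FiniteSet : (Term → Set) → Set
FiniteSet P = Σ (List Term) λ L → ∀ t → P t → t ∈ L

LocallyFinite : Set
LocallyFinite = ∀ s → FiniteSet (λ t → t ≈ s)

PosetProperty : Set
PosetProperty = ∀ s t → s ≼ t → t ≼ s → s ≡ t

MinimalIn : Term → Term → Set
MinimalIn s r = r ≈ s × (∀ u → u ≈ s → u ≼ r → u ≡ r)

Rooted : Set
Rooted = PosetProperty ×
         (∀ s → Σ Term λ r → MinimalIn s r × (∀ r′ → MinimalIn s r′ → r′ ≡ r))

-- Expanding every redex M s to s s, bottom-up, sends each term t to a
-- term expand t that is invariant under ⇒, hence constant on ≈-classes; only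
-- finitely many terms expand to a given term, so the classes are finite. Weighing
-- M as 1 and variables as 2, every step except the loop M M ⇒ M M strictly
-- increases the weight, which gives antisymmetry. Folding every application u u of
-- expand t back into M u yields a term that reduces to every member of the class
-- of t, so it is the least element of that class.
module Submission where

open import Defs
open import Data.Empty using (⊥-elim)
open import Data.List using (List; []; _∷_; _++_; map; cartesianProductWith)
open import Data.List.Membership.Propositional using (_∈_)
open import Data.List.Membership.Propositional.Properties
  using (∈-++⁺ˡ; ∈-++⁺ʳ; ∈-map⁺; ∈-cartesianProductWith⁺)
open import Data.List.Relation.Unary.Any using (here)
open import Data.Nat using (ℕ; _+_; _≤_; _<_; s≤s; z≤n)
import Data.Nat as Nat
open import Data.Nat.Properties using (≤-refl; +-mono-≤; +-monoˡ-≤; +-monoˡ-<; +-monoʳ-<; <-trans; <-irrefl)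
open import Data.Product using (_×_; _,_)
open import Data.Sum using (_⊎_; inj₁; inj₂)
open import Relation.Binary.Core using (Rel)
open import Relation.Binary.Definitions using (DecidableEquality)
open import Relation.Binary.PropositionalEquality
open import Relation.Nullary using (yes; no)
open import Relation.Binary.Construct.Closure.ReflexiveTransitive as Star
  using (Star; ε; _◅_; _◅◅_)
open import Relation.Binary.Construct.Closure.Symmetric using (fwd)
import Relation.Binary.Construct.Closure.Equivalence as EqClosure

_≟_ : DecidableEquality Term
var i ≟ var j with i Nat.≟ j
... | yes refl = yes refl
... | no i≢j   = no λ { refl → i≢j refl }
var _ ≟ M       = no λ ()
var _ ≟ (_ · _) = no λ ()
M ≟ var _       = no λ ()
M ≟ M           = yes refl
M ≟ (_ · _)     = no λ ()
(_ · _) ≟ var _ = no λ ()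
(_ · _) ≟ M     = no λ ()
(a · b) ≟ (c · d) with a ≟ c | b ≟ d
... | yes refl | yes refl = yes refl
... | no a≢c   | _        = no λ { refl → a≢c refl }
... | _        | no b≢d   = no λ { refl → b≢d refl }

≼⇒≈ : ∀ {s t} → s ≼ t → s ≈ t
≼⇒≈ = Star.map fwd

·-mono-≼ : ∀ {a a′ b b′} → a ≼ a′ → b ≼ b′ → a · b ≼ a′ · b′
·-mono-≼ {a′ = a′} {b = b} a≼a′ b≼b′ =
  Star.gmap (_· b) (appˡ b) a≼a′ ◅◅ Star.gmap (a′ ·_) (appʳ a′) b≼b′

infixl 9 _⊙_

_⊙_ : Term → Term → Term
M ⊙ w = w · w
v ⊙ w = v · w

expand : Term → Term
expand (var i) = var i
expand M       = M
expand (a · b) = expand a ⊙ expand b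

⊙-diag : ∀ v → v ⊙ v ≡ v · v
⊙-diag (var _) = refl
⊙-diag M       = refl
⊙-diag (_ · _) = refl

expand-· : ∀ {a} b → a ≢ M → expand (a · b) ≡ expand a · expand b
expand-· {var _}   b _   = refl
expand-· {M}       b a≢M = ⊥-elim (a≢M refl)
expand-· {a₁ · a₂} b _ with expand a₁
... | var _ = refl
... | M     = refl
... | _ · _ = refl

⇒⇒expand≡ : ∀ {t t′} → t ⇒ t′ → expand t ≡ expand t′
⇒⇒expand≡ (mock s)    = sym (⊙-diag (expand s))
⇒⇒expand≡ (appˡ b r) = cong (_⊙ expand b) (⇒⇒expand≡ r)
⇒⇒expand≡ (appʳ a r) = cong (expand a ⊙_) (⇒⇒expand≡ r)

≈⇒expand≡ : ∀ {t t′} → t ≈ t′ → expand t ≡ expand t′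
≈⇒expand≡ = EqClosure.gfold isEquivalence expand ⇒⇒expand≡

preimages : Term → List Term
preimages (var i) = var i ∷ []
preimages M       = M ∷ []
preimages (p · q) =
  cartesianProductWith _·_ (preimages p) (preimages q) ++ map (M ·_) (preimages q)

∈-preimages-expand : ∀ t → t ∈ preimages (expand t)
∈-preimages-expand (var _) = here refl
∈-preimages-expand M       = here refl
∈-preimages-expand (a · b) with a ≟ M
... | yes refl = ∈-++⁺ʳ _ (∈-map⁺ (M ·_) (∈-preimages-expand b))
... | no a≢M rewrite expand-· b a≢M =
  ∈-++⁺ˡ (∈-cartesianProductWith⁺ _·_ (∈-preimages-expand a) (∈-preimages-expand b))

locallyFinite : LocallyFinite
locallyFinite s = preimages (expand s) , λ t t≈s →
  subst (λ u → t ∈ preimages u) (≈⇒expand≡ t≈s) (∈-preimages-expand t)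

module _ {a ℓ} {A : Set a} {R : Rel A ℓ} (weight : A → ℕ)
         (grows : ∀ {x y} → R x y → x ≡ y ⊎ weight x < weight y) where

  Star-grows : ∀ {x y} → Star R x y → x ≡ y ⊎ weight x < weight y
  Star-grows ε = inj₁ refl
  Star-grows (r ◅ rs) with grows r | Star-grows rs
  ... | inj₁ refl | x≡y∨x<y  = x≡y∨x<y
  ... | inj₂ x<z  | inj₁ refl = inj₂ x<z
  ... | inj₂ x<z  | inj₂ z<y  = inj₂ (<-trans x<z z<y)

  Star-antisym : ∀ {x y} → Star R x y → Star R y x → x ≡ y
  Star-antisym xy yx with Star-grows xy | Star-grows yx
  ... | inj₁ x≡y | _         = x≡y
  ... | inj₂ _   | inj₁ y≡x  = sym y≡x
  ... | inj₂ x<y | inj₂ y<x  = ⊥-elim (<-irrefl refl (<-trans x<y y<x))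

weight : Term → ℕ
weight (var _) = 2
weight M       = 1
weight (a · b) = weight a + weight b

1≤weight : ∀ t → 1 ≤ weight t
1≤weight (var _) = s≤s z≤n
1≤weight M       = s≤s z≤n
1≤weight (a · b) = +-mono-≤ (1≤weight a) z≤n

weight-mock : ∀ s → 2 ≤ weight s → weight (M · s) < weight (s · s)
weight-mock s 2≤w = +-monoˡ-≤ (weight s) 2≤w

⇒-grows : ∀ {t t′} → t ⇒ t′ → t ≡ t′ ⊎ weight t < weight t′
⇒-grows (mock M)       = inj₁ refl
⇒-grows (mock (var i)) = inj₂ (weight-mock (var i) ≤-refl)
⇒-grows (mock (a · b)) = inj₂ (weight-mock (a · b) (+-mono-≤ (1≤weight a) (1≤weight b)))
⇒-grows (appˡ b r) with ⇒-grows r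
... | inj₁ refl = inj₁ refl
... | inj₂ w<w′ = inj₂ (+-monoˡ-< (weight b) w<w′)
⇒-grows (appʳ a r) with ⇒-grows r
... | inj₁ refl = inj₁ refl
... | inj₂ w<w′ = inj₂ (+-monoʳ-< (weight a) w<w′)

posetProperty : PosetProperty
posetProperty _ _ = Star-antisym weight ⇒-grows

contract : Term → Term
contract (var i) = var i
contract M       = M
contract (p · q) with p ≟ q
... | yes _ = M · contract p
... | no _  = contract p · contract q

contract-diag : ∀ p → contract (p · p) ≡ M · contract p
contract-diag p with p ≟ p
... | yes _  = refl
... | no p≢p = ⊥-elim (p≢p refl)

contract-·-≼ : ∀ p q → contract (p · q) ≼ contract p · contract q
contract-·-≼ p q with p ≟ q
... | yes refl = mock (contract p) ◅ ε
... | no _     = ε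

root : Term → Term
root t = contract (expand t)

root-≼ : ∀ t → root t ≼ t
root-≼ (var _) = ε
root-≼ M       = ε
root-≼ (a · b) with a ≟ M
... | yes refl rewrite contract-diag (expand b) = ·-mono-≼ ε (root-≼ b)
... | no a≢M rewrite expand-· b a≢M =
  contract-·-≼ (expand a) (expand b) ◅◅ ·-mono-≼ (root-≼ a) (root-≼ b)

≈⇒root≡ : ∀ {s t} → s ≈ t → root s ≡ root t
≈⇒root≡ s≈t = cong contract (≈⇒expand≡ s≈t)

root-minimal : ∀ s → MinimalIn s (root s)
root-minimal s = ≼⇒≈ (root-≼ s) , λ u u≈s u≼root →
  posetProperty u (root s) u≼root (subst (_≼ u) (≈⇒root≡ u≈s) (root-≼ u))

minimal-unique : ∀ s r → MinimalIn s r → r ≡ root s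
minimal-unique s r (r≈s , r-min) = begin
  r       ≡⟨ sym (r-min (root r) (≼⇒≈ (root-≼ r) ◅◅ r≈s) (root-≼ r)) ⟩
  root r  ≡⟨ ≈⇒root≡ r≈s ⟩
  root s  ∎
  where open ≡-Reasoning

rooted : Rooted
rooted = posetProperty , λ s → root s , root-minimal s , minimal-unique s

proposition2p1 : LocallyFinite × PosetProperty × Rooted
proposition2p1 = locallyFinite , posetProperty , rooted
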